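{- Let $k=\mathbb{F}_3(t)$, $d\in k^\times$, and $Q_0=d(u_0^2-tu_1^2)+(t+t^2)u_2^2+tu_2u_3-tu_3u_4$, $Q_\infty=du_0u_1-u_2^2+tu_3^2-u_2u_4+u_4^2$. Then for every $b\in\mathcal{O}_t$, the quadric $\mathbb{V}(bQ_0+Q_\infty)\subset\mathbb{P}^4_{k_t}$ contains no $k_t$-rational line.
   Context: $k_t$ is the completion of $k$ at the place with uniformiser $t$ and $\mathcal{O}_t$ its valuation ring. -}

module Defs where

open import Data.Nat using (ℕ; zero; suc; _∸_; _<ᵇ_)
import Data.Nat
open import Data.Bool using (if_then_else_)
open import Data.List using (List; []; _∷_)
open import Data.List.Relation.Unary.Any using (Any)
open import Data.Fin using (Fin; zero; suc)
open import Data.Product using (Σ; _×_; ∃)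
open import Relation.Binary.PropositionalEquality using (_≡_)
open import Relation.Nullary using (¬_)

data F3 : Set where
  f0 f1 f2 : F3

infixl 6 _+₃_
infixl 7 _*₃_

_+₃_ : F3 → F3 → F3
f0 +₃ y  = y
f1 +₃ f0 = f1
f1 +₃ f1 = f2
f1 +₃ f2 = f0
f2 +₃ f0 = f2
f2 +₃ f1 = f0
f2 +₃ f2 = f1

_*₃_ : F3 → F3 → F3
f0 *₃ y  = f0
f1 *₃ y  = y
f2 *₃ f0 = f0
f2 *₃ f1 = f2
f2 *₃ f2 = f1

neg₃ : F3 → F3
neg₃ f0 = f0
neg₃ f1 = f2
neg₃ f2 = f1

-- Formal power series F₃[[t]] = 𝒪_t, as coefficient sequences

PS : Set
PS = ℕ → F3

sumTo : (ℕ → F3) → ℕ → F3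
sumTo h zero    = h zero
sumTo h (suc n) = sumTo h n +₃ h (suc n)

addPS : PS → PS → PS
addPS f g n = f n +₃ g n

mulPS : PS → PS → PS
mulPS f g n = sumTo (λ i → f i *₃ g (n ∸ i)) n

negPS : PS → PS
negPS f n = neg₃ (f n)

shiftPS : ℕ → PS → PS
shiftPS k f n = if n <ᵇ k then f0 else f (n ∸ k)

-- Laurent series k_t = F₃((t)):  an element  t^(-s) · f  with f ∈ F₃[[t]]

record Kt : Set where
  constructor ⟨_,_⟩
  field
    s   : ℕ
    ser : PS
open Kt public

-- equality in k_t:  t^(-s) f = t^(-s') g  iff  t^(s') f = t^(s) g
infix 4 _≈_
_≈_ : Kt → Kt → Set
x ≈ y = ∀ n → shiftPS (s y) (ser x) n ≡ shiftPS (s x) (ser y) n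

infixl 6 _+_ _-_
infixl 7 _*_

_+_ : Kt → Kt → Kt
x + y = ⟨ s x Data.Nat.+ s y , addPS (shiftPS (s y) (ser x)) (shiftPS (s x) (ser y)) ⟩

_*_ : Kt → Kt → Kt
x * y = ⟨ s x Data.Nat.+ s y , mulPS (ser x) (ser y) ⟩

-_ : Kt → Kt
- x = ⟨ s x , negPS (ser x) ⟩

_-_ : Kt → Kt → Kt
x - y = x + (- y)

ι : PS → Kt
ι f = ⟨ 0 , f ⟩

0K : Kt
0K = ι (λ _ → f0)

tK : Kt
tK = ι (λ { (suc zero) → f1 ; _ → f0 })

-- Polynomials F₃[t] (coefficient lists, constant term first) and k = F₃(t) ⊂ k_t

Poly : Set
Poly = List F3

coeffP : Poly → ℕ → F3
coeffP []       n       = f0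
coeffP (c ∷ cs) zero    = c
coeffP (c ∷ cs) (suc n) = coeffP cs n

ιP : Poly → Kt
ιP p = ι (coeffP p)

NonzeroPoly : Poly → Set
NonzeroPoly p = Any (λ c → ¬ (c ≡ f0)) p

-- d ∈ k^× (viewed inside k_t): d = p/q with p, q ∈ F₃[t], q ≠ 0, and d ≠ 0
InKˣ : Kt → Set
InKˣ d = (¬ (d ≈ 0K)) × Σ Poly (λ p → Σ Poly (λ q → NonzeroPoly q × (d * ιP q ≈ ιP p)))

Vec5 : Set
Vec5 = Fin 5 → Kt

u0 u1 u2 u3 u4 : Vec5 → Kt
u0 u = u zero
u1 u = u (suc zero)
u2 u = u (suc (suc zero))
u3 u = u (suc (suc (suc zero)))
u4 u = u (suc (suc (suc (suc zero))))

Q₀ : Kt → Vec5 → Kt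
Q₀ d u = d * (u0 u * u0 u - tK * (u1 u * u1 u))
       + (tK + tK * tK) * (u2 u * u2 u)
       + tK * (u2 u * u3 u)
       - tK * (u3 u * u4 u)

Q∞ : Kt → Vec5 → Kt
Q∞ d u = d * (u0 u * u1 u)
       - u2 u * u2 u
       + tK * (u3 u * u3 u)
       - u2 u * u4 u
       + u4 u * u4 u

Qb : Kt → Kt → Vec5 → Kt
Qb d b u = b * Q₀ d u + Q∞ d u

-- Lines in P⁴(k_t): 2-dimensional k_t-subspaces of k_t⁵, given by a basis

lin : Kt → Vec5 → Kt → Vec5 → Vec5
lin a v c w i = a * v i + c * w i

LinIndep : Vec5 → Vec5 → Set
LinIndep v w = ∀ a c → (∀ i → lin a v c w i ≈ 0K) → (a ≈ 0K) × (c ≈ 0K)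

ContainsRationalLine : (Vec5 → Kt) → Set
ContainsRationalLine Q =
  Σ Vec5 (λ v → Σ Vec5 (λ w → LinIndep v w × (∀ a c → Q (lin a v c w) ≈ 0K)))

{-# OPTIONS --safe #-}
module Submission where

-- Write b Q₀ + Q∞ = H(u₀, u₁) + P(u₂, u₃, u₄).  The ternary form P and the quaternary form
-- G(z, e) = adj P(z) − e² (1 + b²t) are anisotropic over k_t.  Reducing modulo t twice (the
-- second time after dividing by t the coordinates already known to vanish) shows that every
-- coordinate of a zero in 𝒪_t is divisible by t; by homogeneity the zero can then be divided
-- by t, so it is 0 by infinite descent, and clearing denominators handles zeros in k_t.
-- If the quadric contained the line spanned by v and w, then H = −P at v, w and v + w, so
-- the discriminants of H and of P restricted to the line agree.  The first is (Δd)² (1 + b²t)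
-- with Δ = v₀w₁ − v₁w₀, the second is adj P(v × w); hence G(v × w, Δd) = 0 and Δ = 0.  Then
-- some nonzero point of the line has u₀ = u₁ = 0, where Q = P, contradicting the anisotropy
-- of P.

open import Data.Nat using (ℕ; zero; suc; _∸_; _≤_) renaming (_+_ to _+ℕ_)
import Data.Nat.Properties as ℕ
open import Data.Product using (_×_; _,_; proj₁; proj₂)
open import Data.Empty using (⊥-elim)
open import Data.Maybe using (Maybe; just; nothing)
open import Data.Fin using (Fin; #_) renaming (zero to fzero; suc to fsuc)
open import Data.Vec using (Vec; []; _∷_)
open import Data.Vec.Relation.Binary.Pointwise.Inductive as Pointwise using (Pointwise; []; _∷_)
open import Function using (_∘_)
open import Relation.Binary.PropositionalEquality
  using (_≡_; _≢_; _≗_; refl; sym; trans; cong; cong₂; module ≡-Reasoning)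
open import Relation.Binary.Definitions using (DecidableEquality)
open import Relation.Binary.Structures using (IsEquivalence)
open import Relation.Binary.Bundles using (Setoid)
import Relation.Binary.Reasoning.Setoid as SetoidReasoning
open import Relation.Nullary using (¬_; Dec; yes; no)
open import Relation.Nullary.Decidable using (from-yes; ¬?; _→-dec_; _×-dec_)
open import Algebra.Bundles using (RawRing)
open import Algebra.Structures using (IsCommutativeSemiring)
open import Algebra.Solver.Ring.AlmostCommutativeRing
  using (AlmostCommutativeRing; _-Raw-AlmostCommutative⟶_)
import Algebra.Solver.Ring as RingSolver
import Algebra.Properties.Semiring.Exp as Exp

-- The forms are written once over any ring and instantiated both in k_t and in the solver's
-- polynomials.  Q is b Q₀ + Q∞ spelled exactly as in Defs, so Qb d b u is definitionally
-- Q b d (u0 u) … (u4 u).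
module Forms {c ℓ} (R : RawRing c ℓ) (t : RawRing.Carrier R) where
  open RawRing R

  infixl 6 _-_
  _-_ : Carrier → Carrier → Carrier
  x - y = x + - y

  -- For h = (f v, f w, f (v + w)) this is the discriminant of the binary quadratic form
  -- f (λ v + μ w), using 4 = 1 in characteristic 3.
  disc : (h₁ h₂ h₃ : Carrier) → Carrier
  disc h₁ h₂ h₃ = (h₃ - h₁ - h₂) * (h₃ - h₁ - h₂) - h₁ * h₂

  module _ (b : Carrier) where

    Q : (d u₀ u₁ u₂ u₃ u₄ : Carrier) → Carrier
    Q d u₀ u₁ u₂ u₃ u₄ =
      b * (d * (u₀ * u₀ - t * (u₁ * u₁)) + (t + t * t) * (u₂ * u₂) + t * (u₂ * u₃) - t * (u₃ * u₄))
      + (d * (u₀ * u₁) - u₂ * u₂ + t * (u₃ * u₃) - u₂ * u₄ + u₄ * u₄)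

    P : (x₂ x₃ x₄ : Carrier) → Carrier
    P x₂ x₃ x₄ = b * ((t + t * t) * (x₂ * x₂) + t * (x₂ * x₃) - t * (x₃ * x₄))
               + (- (x₂ * x₂) + t * (x₃ * x₃) - x₂ * x₄ + x₄ * x₄)

    -- P′ and G′ are P and G with t x substituted for the coordinates x that vanish mod t,
    -- divided by t.
    P′ : (x₂ x₃ x₄ : Carrier) → Carrier
    P′ x₂ x₃ x₄ = b * ((t + t * t) * t * (x₂ * x₂) + t * (x₂ * x₃) - t * (x₃ * x₄))
               + (- (t * (x₂ * x₂)) + x₃ * x₃ - t * (x₂ * x₄) + t * (x₄ * x₄))

    U : Carrier
    U = 1# + b * b * t

    -- Minus the adjoint form of P.
    adjP : (z₂ z₃ z₄ : Carrier) → Carrier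
    adjP z₂ z₃ z₄ = - ((t - b * b * (t * t)) * (z₂ * z₂) + b * t * (z₂ * z₃) + (b * b * (t * t) + t) * (z₂ * z₄)
                       + (1# + b * t + b * (t * t)) * (z₃ * z₃) + b * b * (t * t) * (1# + t) * (z₃ * z₄)
                       + (b * (t * t) * (1# + t) - b * b * (t * t) - t) * (z₄ * z₄))

    G : (z₂ z₃ z₄ e : Carrier) → Carrier
    G z₂ z₃ z₄ e = adjP z₂ z₃ z₄ - e * e * U

    G′ : (z₂ z₃ z₄ e : Carrier) → Carrier
    G′ z₂ z₃ z₄ e = - ((1# - b * b * t) * (z₂ * z₂) + b * t * (z₂ * z₃) + (1# + b * b * t) * (z₂ * z₄)
                      + t * (1# + b * t + b * (t * t)) * (z₃ * z₃) + b * b * (t * t) * (1# + t) * (z₃ * z₄)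
                      + (b * t * (1# + t) - b * b * t - 1#) * (z₄ * z₄))
                   - t * (e * e * U)

    H : (d u₀ u₁ : Carrier) → Carrier
    H d u₀ u₁ = b * (d * (u₀ * u₀ - t * (u₁ * u₁))) + d * (u₀ * u₁)

open import Defs

infix 4 _≟₃_

_≟₃_ : DecidableEquality F3
f0 ≟₃ f0 = yes refl
f0 ≟₃ f1 = no λ ()
f0 ≟₃ f2 = no λ ()
f1 ≟₃ f0 = no λ ()
f1 ≟₃ f1 = yes refl
f1 ≟₃ f2 = no λ ()
f2 ≟₃ f0 = no λ ()
f2 ≟₃ f1 = no λ ()
f2 ≟₃ f2 = yes refl

f1≢f0 : f1 ≢ f0
f1≢f0 ()

∀₃? : {P : F3 → Set} → (∀ x → Dec (P x)) → Dec (∀ x → P x)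
∀₃? P? with P? f0 | P? f1 | P? f2
... | yes p₀ | yes p₁ | yes p₂ = yes λ { f0 → p₀ ; f1 → p₁ ; f2 → p₂ }
... | no ¬p  | _      | _      = no λ p → ¬p (p f0)
... | _      | no ¬p  | _      = no λ p → ¬p (p f1)
... | _      | _      | no ¬p  = no λ p → ¬p (p f2)

+₃-identityʳ : ∀ a → a +₃ f0 ≡ a
+₃-identityʳ = from-yes (∀₃? λ a → a +₃ f0 ≟₃ a)

+₃-comm : ∀ a b → a +₃ b ≡ b +₃ a
+₃-comm = from-yes (∀₃? λ a → ∀₃? λ b → a +₃ b ≟₃ b +₃ a)

+₃-assoc : ∀ a b c → (a +₃ b) +₃ c ≡ a +₃ (b +₃ c)
+₃-assoc = from-yes (∀₃? λ a → ∀₃? λ b → ∀₃? λ c → (a +₃ b) +₃ c ≟₃ a +₃ (b +₃ c))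

+₃-interchange : ∀ a b c d → (a +₃ b) +₃ (c +₃ d) ≡ (a +₃ c) +₃ (b +₃ d)
+₃-interchange = from-yes (∀₃? λ a → ∀₃? λ b → ∀₃? λ c → ∀₃? λ d →
  (a +₃ b) +₃ (c +₃ d) ≟₃ (a +₃ c) +₃ (b +₃ d))

*₃-comm : ∀ a b → a *₃ b ≡ b *₃ a
*₃-comm = from-yes (∀₃? λ a → ∀₃? λ b → a *₃ b ≟₃ b *₃ a)

*₃-assoc : ∀ a b c → (a *₃ b) *₃ c ≡ a *₃ (b *₃ c)
*₃-assoc = from-yes (∀₃? λ a → ∀₃? λ b → ∀₃? λ c → (a *₃ b) *₃ c ≟₃ a *₃ (b *₃ c))

*₃-zeroʳ : ∀ a → a *₃ f0 ≡ f0
*₃-zeroʳ = from-yes (∀₃? λ a → a *₃ f0 ≟₃ f0)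

*₃-distribˡ : ∀ a b c → a *₃ (b +₃ c) ≡ a *₃ b +₃ a *₃ c
*₃-distribˡ = from-yes (∀₃? λ a → ∀₃? λ b → ∀₃? λ c → a *₃ (b +₃ c) ≟₃ a *₃ b +₃ a *₃ c)

*₃-distribʳ : ∀ a b c → (b +₃ c) *₃ a ≡ b *₃ a +₃ c *₃ a
*₃-distribʳ = from-yes (∀₃? λ a → ∀₃? λ b → ∀₃? λ c → (b +₃ c) *₃ a ≟₃ b *₃ a +₃ c *₃ a)

neg₃-+₃ : ∀ a b → neg₃ a +₃ neg₃ b ≡ neg₃ (a +₃ b)
neg₃-+₃ = from-yes (∀₃? λ a → ∀₃? λ b → neg₃ a +₃ neg₃ b ≟₃ neg₃ (a +₃ b))

*₃-nonzero : ∀ a b → a ≢ f0 → b ≢ f0 → a *₃ b ≢ f0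
*₃-nonzero = from-yes (∀₃? λ a → ∀₃? λ b →
  ¬? (a ≟₃ f0) →-dec ¬? (b ≟₃ f0) →-dec ¬? (a *₃ b ≟₃ f0))

constPS : F3 → PS
constPS c zero    = c
constPS c (suc _) = f0

zeroPS onePS : PS
zeroPS _ = f0
onePS = constPS f1

tailPS : PS → PS
tailPS f n = f (suc n)

scalePS : F3 → PS → PS
scalePS c f n = c *₃ f n

≗-isEquivalence : IsEquivalence (_≗_ {A = ℕ} {B = F3})
≗-isEquivalence = record
  { refl = λ _ → refl ; sym = λ p n → sym (p n) ; trans = λ p q n → trans (p n) (q n) }

PS-setoid : Setoid _ _
PS-setoid = record { isEquivalence = ≗-isEquivalence }

open IsEquivalence ≗-isEquivalence
  using () renaming (refl to ≗-refl; sym to ≗-sym; trans to ≗-trans)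

sumTo-suc : ∀ h n → sumTo h (suc n) ≡ h 0 +₃ sumTo (h ∘ suc) n
sumTo-suc h zero    = refl
sumTo-suc h (suc n) = trans (cong (_+₃ h (suc (suc n))) (sumTo-suc h n)) (+₃-assoc (h 0) _ _)

sumTo-cong : ∀ {h h′} → h ≗ h′ → sumTo h ≗ sumTo h′
sumTo-cong p zero    = p 0
sumTo-cong p (suc n) = cong₂ _+₃_ (sumTo-cong p n) (p (suc n))

mulPS-suc : ∀ f g n → mulPS f g (suc n) ≡ f 0 *₃ g (suc n) +₃ mulPS (tailPS f) g n
mulPS-suc f g n = sumTo-suc (λ i → f i *₃ g (suc n ∸ i)) n

addPS-cong : ∀ {f f′ g g′} → f ≗ f′ → g ≗ g′ → addPS f g ≗ addPS f′ g′
addPS-cong p q n = cong₂ _+₃_ (p n) (q n)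

mulPS-cong : ∀ {f f′ g g′} → f ≗ f′ → g ≗ g′ → mulPS f g ≗ mulPS f′ g′
mulPS-cong p q n = sumTo-cong (λ i → cong₂ _*₃_ (p i) (q (n ∸ i))) n

negPS-cong : ∀ {f f′} → f ≗ f′ → negPS f ≗ negPS f′
negPS-cong p n = cong neg₃ (p n)

mulPS-zeroˡ : ∀ g → mulPS zeroPS g ≗ zeroPS
mulPS-zeroˡ g zero    = refl
mulPS-zeroˡ g (suc n) = trans (mulPS-suc zeroPS g n) (mulPS-zeroˡ g n)

mulPS-identityˡ : ∀ g → mulPS onePS g ≗ g
mulPS-identityˡ g zero    = refl
mulPS-identityˡ g (suc n) =
  trans (mulPS-suc onePS g n) (trans (cong (g (suc n) +₃_) (mulPS-zeroˡ g n)) (+₃-identityʳ _))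

mulPS-scaleˡ : ∀ c f g → mulPS (scalePS c f) g ≗ scalePS c (mulPS f g)
mulPS-scaleˡ c f g zero    = *₃-assoc c (f 0) (g 0)
mulPS-scaleˡ c f g (suc n) = begin
  mulPS (scalePS c f) g (suc n)                         ≡⟨ mulPS-suc (scalePS c f) g n ⟩
  (c *₃ f 0) *₃ g (suc n) +₃ mulPS (scalePS c (tailPS f)) g n
    ≡⟨ cong₂ _+₃_ (*₃-assoc c (f 0) (g (suc n))) (mulPS-scaleˡ c (tailPS f) g n) ⟩
  c *₃ (f 0 *₃ g (suc n)) +₃ c *₃ mulPS (tailPS f) g n  ≡⟨ *₃-distribˡ c _ _ ⟨
  c *₃ (f 0 *₃ g (suc n) +₃ mulPS (tailPS f) g n)       ≡⟨ cong (c *₃_) (mulPS-suc f g n) ⟨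
  scalePS c (mulPS f g) (suc n)                         ∎
  where open ≡-Reasoning

mulPS-distribʳ : ∀ h f g → mulPS (addPS f g) h ≗ addPS (mulPS f h) (mulPS g h)
mulPS-distribʳ h f g zero    = *₃-distribʳ (h 0) (f 0) (g 0)
mulPS-distribʳ h f g (suc n) = begin
  mulPS (addPS f g) h (suc n)
    ≡⟨ mulPS-suc (addPS f g) h n ⟩
  (f 0 +₃ g 0) *₃ h (suc n) +₃ mulPS (addPS (tailPS f) (tailPS g)) h n
    ≡⟨ cong₂ _+₃_ (*₃-distribʳ (h (suc n)) (f 0) (g 0)) (mulPS-distribʳ h (tailPS f) (tailPS g) n) ⟩
  (f 0 *₃ h (suc n) +₃ g 0 *₃ h (suc n)) +₃ (mulPS (tailPS f) h n +₃ mulPS (tailPS g) h n)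
    ≡⟨ +₃-interchange (f 0 *₃ h (suc n)) _ (mulPS (tailPS f) h n) _ ⟩
  (f 0 *₃ h (suc n) +₃ mulPS (tailPS f) h n) +₃ (g 0 *₃ h (suc n) +₃ mulPS (tailPS g) h n)
    ≡⟨ cong₂ _+₃_ (mulPS-suc f h n) (mulPS-suc g h n) ⟨
  addPS (mulPS f h) (mulPS g h) (suc n) ∎
  where open ≡-Reasoning

mulPS-distribˡ : ∀ f g h → mulPS f (addPS g h) ≗ addPS (mulPS f g) (mulPS f h)
mulPS-distribˡ f g h zero    = *₃-distribˡ (f 0) (g 0) (h 0)
mulPS-distribˡ f g h (suc n) = begin
  mulPS f (addPS g h) (suc n)
    ≡⟨ mulPS-suc f (addPS g h) n ⟩
  f 0 *₃ (g (suc n) +₃ h (suc n)) +₃ mulPS (tailPS f) (addPS g h) n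
    ≡⟨ cong₂ _+₃_ (*₃-distribˡ (f 0) (g (suc n)) (h (suc n))) (mulPS-distribˡ (tailPS f) g h n) ⟩
  (f 0 *₃ g (suc n) +₃ f 0 *₃ h (suc n)) +₃ (mulPS (tailPS f) g n +₃ mulPS (tailPS f) h n)
    ≡⟨ +₃-interchange (f 0 *₃ g (suc n)) _ (mulPS (tailPS f) g n) _ ⟩
  (f 0 *₃ g (suc n) +₃ mulPS (tailPS f) g n) +₃ (f 0 *₃ h (suc n) +₃ mulPS (tailPS f) h n)
    ≡⟨ cong₂ _+₃_ (mulPS-suc f g n) (mulPS-suc f h n) ⟨
  addPS (mulPS f g) (mulPS f h) (suc n) ∎
  where open ≡-Reasoning

mulPS-comm : ∀ f g → mulPS f g ≗ mulPS g f
mulPS-comm f g zero          = *₃-comm (f 0) (g 0)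
mulPS-comm f g (suc zero)    =
  trans (mulPS-suc f g 0)
  (trans (cong₂ _+₃_ (*₃-comm (f 0) (g 1)) (*₃-comm (f 1) (g 0)))
  (trans (+₃-comm (g 1 *₃ f 0) (g 0 *₃ f 1)) (sym (mulPS-suc g f 0))))
mulPS-comm f g (suc (suc n)) = begin
  mulPS f g (suc (suc n))
    ≡⟨ mulPS-suc f g (suc n) ⟩
  f₀g +₃ mulPS (tailPS f) g (suc n)
    ≡⟨ cong (f₀g +₃_) (trans (mulPS-comm (tailPS f) g (suc n)) (mulPS-suc g (tailPS f) n)) ⟩
  f₀g +₃ (g₀f +₃ mulPS (tailPS g) (tailPS f) n)
    ≡⟨ cong (λ x → f₀g +₃ (g₀f +₃ x)) (mulPS-comm (tailPS g) (tailPS f) n) ⟩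
  f₀g +₃ (g₀f +₃ mulPS (tailPS f) (tailPS g) n)
    ≡⟨ +₃-leftComm f₀g g₀f _ ⟩
  g₀f +₃ (f₀g +₃ mulPS (tailPS f) (tailPS g) n)
    ≡⟨ cong (g₀f +₃_) (trans (mulPS-comm (tailPS g) f (suc n)) (mulPS-suc f (tailPS g) n)) ⟨
  g₀f +₃ mulPS (tailPS g) f (suc n)
    ≡⟨ mulPS-suc g f (suc n) ⟨
  mulPS g f (suc (suc n)) ∎
  where
  open ≡-Reasoning
  f₀g g₀f : F3
  f₀g = f 0 *₃ g (suc (suc n))
  g₀f = g 0 *₃ f (suc (suc n))
  +₃-leftComm : ∀ a b c → a +₃ (b +₃ c) ≡ b +₃ (a +₃ c)
  +₃-leftComm = from-yes (∀₃? λ a → ∀₃? λ b → ∀₃? λ c → a +₃ (b +₃ c) ≟₃ b +₃ (a +₃ c))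

mulPS-assoc : ∀ f g h → mulPS (mulPS f g) h ≗ mulPS f (mulPS g h)
mulPS-assoc f g h zero    = *₃-assoc (f 0) (g 0) (h 0)
mulPS-assoc f g h (suc n) = begin
  mulPS (mulPS f g) h (suc n)
    ≡⟨ mulPS-suc (mulPS f g) h n ⟩
  (f 0 *₃ g 0) *₃ h (suc n) +₃ mulPS (tailPS (mulPS f g)) h n
    ≡⟨ cong ((f 0 *₃ g 0) *₃ h (suc n) +₃_) tail-product ⟩
  (f 0 *₃ g 0) *₃ h (suc n) +₃ (f 0 *₃ mulPS (tailPS g) h n +₃ mulPS (tailPS f) (mulPS g h) n)
    ≡⟨ rearrange (f 0) (g 0) (h (suc n)) _ _ ⟩
  f 0 *₃ (g 0 *₃ h (suc n) +₃ mulPS (tailPS g) h n) +₃ mulPS (tailPS f) (mulPS g h) n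
    ≡⟨ cong (λ x → f 0 *₃ x +₃ mulPS (tailPS f) (mulPS g h) n) (mulPS-suc g h n) ⟨
  f 0 *₃ mulPS g h (suc n) +₃ mulPS (tailPS f) (mulPS g h) n
    ≡⟨ mulPS-suc f (mulPS g h) n ⟨
  mulPS f (mulPS g h) (suc n) ∎
  where
  open ≡-Reasoning
  rearrange : ∀ a b c x y → (a *₃ b) *₃ c +₃ (a *₃ x +₃ y) ≡ a *₃ (b *₃ c +₃ x) +₃ y
  rearrange = from-yes (∀₃? λ a → ∀₃? λ b → ∀₃? λ c → ∀₃? λ x → ∀₃? λ y →
    (a *₃ b) *₃ c +₃ (a *₃ x +₃ y) ≟₃ a *₃ (b *₃ c +₃ x) +₃ y)
  tail-product : mulPS (tailPS (mulPS f g)) h n ≡ f 0 *₃ mulPS (tailPS g) h n +₃ mulPS (tailPS f) (mulPS g h) n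
  tail-product = trans (mulPS-cong {g = h} (mulPS-suc f g) ≗-refl n)
    (trans (mulPS-distribʳ h (scalePS (f 0) (tailPS g)) (mulPS (tailPS f) g) n)
    (cong₂ _+₃_ (mulPS-scaleˡ (f 0) (tailPS g) h n) (mulPS-assoc (tailPS f) g h n)))

PS-isCommutativeSemiring : IsCommutativeSemiring _≗_ addPS mulPS zeroPS onePS
PS-isCommutativeSemiring = record
  { isSemiring = record
    { isSemiringWithoutAnnihilatingZero = record
      { +-isCommutativeMonoid = record
        { isMonoid = record
          { isSemigroup = record
            { isMagma = record { isEquivalence = ≗-isEquivalence ; ∙-cong = addPS-cong }
            ; assoc = λ f g h n → +₃-assoc (f n) (g n) (h n) }
          ; identity = (λ f n → refl) , (λ f n → +₃-identityʳ (f n)) }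
        ; comm = λ f g n → +₃-comm (f n) (g n) }
      ; *-cong = mulPS-cong
      ; *-assoc = mulPS-assoc
      ; *-identity = mulPS-identityˡ , λ f → ≗-trans (mulPS-comm f onePS) (mulPS-identityˡ f)
      ; distrib = mulPS-distribˡ , mulPS-distribʳ }
    ; zero = mulPS-zeroˡ , λ f → ≗-trans (mulPS-comm f zeroPS) (mulPS-zeroˡ f) }
  ; *-comm = mulPS-comm }

PS-ring : AlmostCommutativeRing _ _
PS-ring = record
  { Carrier = PS ; _≈_ = _≗_ ; _+_ = addPS ; _*_ = mulPS ; -_ = negPS ; 0# = zeroPS ; 1# = onePS
  ; isAlmostCommutativeRing = record
    { isCommutativeSemiring = PS-isCommutativeSemiring
    ; -‿cong = negPS-cong
    ; -‿*-distribˡ = λ f g → ≗-trans (mulPS-cong {g = g} negPS≗scalePS ≗-refl)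
        (≗-trans (mulPS-scaleˡ f2 f g) (≗-sym negPS≗scalePS))
    ; -‿+-comm = λ f g n → neg₃-+₃ (f n) (g n) } }
  where
  negPS≗scalePS : ∀ {f} → negPS f ≗ scalePS f2 f
  negPS≗scalePS {f} n = from-yes (∀₃? λ a → neg₃ a ≟₃ f2 *₃ a) (f n)

F3-rawRing : RawRing _ _
F3-rawRing = record
  { Carrier = F3 ; _≈_ = _≡_ ; _+_ = _+₃_ ; _*_ = _*₃_ ; -_ = neg₃ ; 0# = f0 ; 1# = f1 }

constPS-morphism : F3-rawRing -Raw-AlmostCommutative⟶ PS-ring
constPS-morphism = record
  { ⟦_⟧ = constPS
  ; +-homo = λ { a b zero → refl ; a b (suc n) → refl }
  ; *-homo = λ { a b zero → refl ; a b (suc n) → sym (trans (mulPS-suc (constPS a) (constPS b) n)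
                   (cong₂ _+₃_ (*₃-zeroʳ a) (mulPS-zeroˡ (constPS b) n))) }
  ; -‿homo = λ { a zero → refl ; a (suc n) → refl }
  ; 0-homo = λ { zero → refl ; (suc n) → refl }
  ; 1-homo = λ { zero → refl ; (suc n) → refl } }

constPS-≟ : ∀ a b → Maybe (constPS a ≗ constPS b)
constPS-≟ a b with a ≟₃ b
... | yes refl = just ≗-refl
... | no _     = nothing

module PS-Solver = RingSolver F3-rawRing PS-ring constPS-morphism constPS-≟

tail-zero-divisor : ∀ {f g} → f 0 ≡ f0 → mulPS f g ≗ zeroPS → mulPS (tailPS f) g ≗ zeroPS
tail-zero-divisor {f} {g} f₀≡0 fg≗0 k = begin
  mulPS (tailPS f) g k                     ≡⟨ cong (λ a → a *₃ g (suc k) +₃ mulPS (tailPS f) g k) f₀≡0 ⟨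
  f 0 *₃ g (suc k) +₃ mulPS (tailPS f) g k ≡⟨ mulPS-suc f g k ⟨
  mulPS f g (suc k)                        ≡⟨ fg≗0 (suc k) ⟩
  f0                                       ∎
  where open ≡-Reasoning

mulPS-nonzero : ∀ n m {f g} → f n ≢ f0 → g m ≢ f0 → ¬ mulPS f g ≗ zeroPS
mulPS-nonzero n m {f} {g} fₙ≢0 gₘ≢0 fg≗0 with f 0 ≟₃ f0 | g 0 ≟₃ f0
mulPS-nonzero zero    m       {f} {g} fₙ≢0 gₘ≢0 fg≗0 | yes f₀≡0 | _ = fₙ≢0 f₀≡0
mulPS-nonzero (suc n) m       {f} {g} fₙ≢0 gₘ≢0 fg≗0 | yes f₀≡0 | _ =
  mulPS-nonzero n m {tailPS f} {g} fₙ≢0 gₘ≢0 (tail-zero-divisor {f} {g} f₀≡0 fg≗0)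
mulPS-nonzero n       zero    {f} {g} fₙ≢0 gₘ≢0 fg≗0 | no _ | yes g₀≡0 = gₘ≢0 g₀≡0
mulPS-nonzero n       (suc m) {f} {g} fₙ≢0 gₘ≢0 fg≗0 | no _ | yes g₀≡0 =
  mulPS-nonzero n m {f} {tailPS g} fₙ≢0 gₘ≢0
    (≗-trans (mulPS-comm f (tailPS g)) (tail-zero-divisor {g} {f} g₀≡0 (≗-trans (mulPS-comm g f) fg≗0)))
mulPS-nonzero n m {f} {g} fₙ≢0 gₘ≢0 fg≗0 | no f₀≢0 | no g₀≢0 = *₃-nonzero (f 0) (g 0) f₀≢0 g₀≢0 (fg≗0 0)

mulPS-cancel-zero : ∀ f g → ¬ f ≗ zeroPS → mulPS f g ≗ zeroPS → g ≗ zeroPS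
mulPS-cancel-zero f g f≉0 fg≗0 m with g m ≟₃ f0
... | yes gₘ≡0 = gₘ≡0
... | no gₘ≢0  = ⊥-elim (f≉0 f≗0)
  where
  f≗0 : f ≗ zeroPS
  f≗0 n with f n ≟₃ f0
  ... | yes fₙ≡0 = fₙ≡0
  ... | no fₙ≢0  = ⊥-elim (mulPS-nonzero n m {f} {g} fₙ≢0 gₘ≢0 fg≗0)

t^_ : ℕ → PS
t^ k = shiftPS k onePS

shiftPS-cong : ∀ k {f g} → f ≗ g → shiftPS k f ≗ shiftPS k g
shiftPS-cong zero    p n       = p n
shiftPS-cong (suc k) p zero    = refl
shiftPS-cong (suc k) p (suc n) = shiftPS-cong k p n

shiftPS-≡ : ∀ {a b} f → a ≡ b → shiftPS a f ≗ shiftPS b f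
shiftPS-≡ f refl = ≗-refl

shiftPS-+ : ∀ a b f → shiftPS (a +ℕ b) f ≗ shiftPS a (shiftPS b f)
shiftPS-+ zero    b f n       = refl
shiftPS-+ (suc a) b f zero    = refl
shiftPS-+ (suc a) b f (suc n) = shiftPS-+ a b f n

shiftPS-comm : ∀ a b f → shiftPS a (shiftPS b f) ≗ shiftPS b (shiftPS a f)
shiftPS-comm a b f =
  ≗-trans (≗-sym (shiftPS-+ a b f)) (≗-trans (shiftPS-≡ f (ℕ.+-comm a b)) (shiftPS-+ b a f))

shiftPS-injective : ∀ k {f g} → shiftPS k f ≗ shiftPS k g → f ≗ g
shiftPS-injective zero    p n = p n
shiftPS-injective (suc k) {f} {g} p = shiftPS-injective k {f} {g} (p ∘ suc)

shiftPS-zero : ∀ k → shiftPS k zeroPS ≗ zeroPS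
shiftPS-zero zero    n       = refl
shiftPS-zero (suc k) zero    = refl
shiftPS-zero (suc k) (suc n) = shiftPS-zero k n

shiftPS-neg : ∀ k f → shiftPS k (negPS f) ≗ negPS (shiftPS k f)
shiftPS-neg zero    f n       = refl
shiftPS-neg (suc k) f zero    = refl
shiftPS-neg (suc k) f (suc n) = shiftPS-neg k f n

shiftPS≗t^* : ∀ k f → shiftPS k f ≗ mulPS (t^ k) f
shiftPS≗t^* zero    f n       = sym (trans (mulPS-cong {g = f} (λ _ → refl) ≗-refl n) (mulPS-identityˡ f n))
shiftPS≗t^* (suc k) f zero    = refl
shiftPS≗t^* (suc k) f (suc n) = trans (shiftPS≗t^* k f n) (sym (mulPS-suc (t^ suc k) f n))

t^-+ : ∀ a b → t^ (a +ℕ b) ≗ mulPS (t^ a) (t^ b)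
t^-+ a b = ≗-trans (shiftPS-+ a b onePS) (shiftPS≗t^* a (t^ b))

≈-refl : ∀ {x} → x ≈ x
≈-refl n = refl

≈-sym : ∀ {x y} → x ≈ y → y ≈ x
≈-sym p n = sym (p n)

≈-trans : ∀ {x y z} → x ≈ y → y ≈ z → x ≈ z
≈-trans {⟨ a , f ⟩} {⟨ b , g ⟩} {⟨ c , h ⟩} p q = shiftPS-injective b (begin
  shiftPS b (shiftPS c f) ≈⟨ shiftPS-comm b c f ⟩
  shiftPS c (shiftPS b f) ≈⟨ shiftPS-cong c p ⟩
  shiftPS c (shiftPS a g) ≈⟨ shiftPS-comm c a g ⟩
  shiftPS a (shiftPS c g) ≈⟨ shiftPS-cong a q ⟩
  shiftPS a (shiftPS b h) ≈⟨ shiftPS-comm a b h ⟩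
  shiftPS b (shiftPS a h) ∎)
  where open SetoidReasoning PS-setoid

≈-isEquivalence : IsEquivalence _≈_
≈-isEquivalence = record
  { refl = λ {x} → ≈-refl {x} ; sym = λ {x} {y} → ≈-sym {x} {y} ; trans = λ {x} {y} {z} → ≈-trans {x} {y} {z} }

Kt-setoid : Setoid _ _
Kt-setoid = record { isEquivalence = ≈-isEquivalence }

≈⇒cross : ∀ {x y} → x ≈ y → mulPS (t^ s y) (ser x) ≗ mulPS (t^ s x) (ser y)
≈⇒cross {x} {y} p = ≗-trans (≗-sym (shiftPS≗t^* (s y) (ser x))) (≗-trans p (shiftPS≗t^* (s x) (ser y)))

cross⇒≈ : ∀ {x y} → mulPS (t^ s y) (ser x) ≗ mulPS (t^ s x) (ser y) → x ≈ y
cross⇒≈ {x} {y} p = ≗-trans (shiftPS≗t^* (s y) (ser x)) (≗-trans p (≗-sym (shiftPS≗t^* (s x) (ser y))))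

ser-+ : ∀ x y → ser (x + y) ≗ addPS (mulPS (t^ s y) (ser x)) (mulPS (t^ s x) (ser y))
ser-+ x y = addPS-cong (shiftPS≗t^* (s y) (ser x)) (shiftPS≗t^* (s x) (ser y))

module _ where
  open PS-Solver using (solve; _:=_; _:+_; _:*_)
  open SetoidReasoning PS-setoid

  +-cong : ∀ {x x′ y y′} → x ≈ x′ → y ≈ y′ → x + y ≈ x′ + y′
  +-cong {x@(⟨ a , f ⟩)} {x′@(⟨ a′ , f′ ⟩)} {y@(⟨ b , g ⟩)} {y′@(⟨ b′ , g′ ⟩)} p q = cross⇒≈ {x + y} {x′ + y′} (begin
    mulPS (t^ (a′ +ℕ b′)) (ser (x + y))
      ≈⟨ mulPS-cong (t^-+ a′ b′) (ser-+ x y) ⟩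
    mulPS (mulPS (t^ a′) (t^ b′)) (addPS (mulPS (t^ b) f) (mulPS (t^ a) g))
      ≈⟨ solve 6 (λ A A′ B B′ F G → (A′ :* B′) :* (B :* F :+ A :* G) := B′ :* B :* (A′ :* F) :+ A′ :* A :* (B′ :* G))
           (λ _ → refl) (t^ a) (t^ a′) (t^ b) (t^ b′) f g ⟩
    addPS (mulPS (mulPS (t^ b′) (t^ b)) (mulPS (t^ a′) f)) (mulPS (mulPS (t^ a′) (t^ a)) (mulPS (t^ b′) g))
      ≈⟨ addPS-cong (mulPS-cong {f = mulPS (t^ b′) (t^ b)} ≗-refl (≈⇒cross {x} {x′} p))
                    (mulPS-cong {f = mulPS (t^ a′) (t^ a)} ≗-refl (≈⇒cross {y} {y′} q)) ⟩
    addPS (mulPS (mulPS (t^ b′) (t^ b)) (mulPS (t^ a) f′)) (mulPS (mulPS (t^ a′) (t^ a)) (mulPS (t^ b) g′))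
      ≈⟨ solve 6 (λ A A′ B B′ F′ G′ → B′ :* B :* (A :* F′) :+ A′ :* A :* (B :* G′) := (A :* B) :* (B′ :* F′ :+ A′ :* G′))
           (λ _ → refl) (t^ a) (t^ a′) (t^ b) (t^ b′) f′ g′ ⟩
    mulPS (mulPS (t^ a) (t^ b)) (addPS (mulPS (t^ b′) f′) (mulPS (t^ a′) g′))
      ≈⟨ mulPS-cong (t^-+ a b) (ser-+ x′ y′) ⟨
    mulPS (t^ (a +ℕ b)) (ser (x′ + y′)) ∎)

  +-comm : ∀ x y → x + y ≈ y + x
  +-comm x@(⟨ a , f ⟩) y@(⟨ b , g ⟩) = cross⇒≈ {x + y} {y + x} (begin
    mulPS (t^ (b +ℕ a)) (ser (x + y))
      ≈⟨ mulPS-cong (t^-+ b a) (ser-+ x y) ⟩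
    mulPS (mulPS (t^ b) (t^ a)) (addPS (mulPS (t^ b) f) (mulPS (t^ a) g))
      ≈⟨ solve 4 (λ A B F G → (B :* A) :* (B :* F :+ A :* G) := (A :* B) :* (A :* G :+ B :* F))
           (λ _ → refl) (t^ a) (t^ b) f g ⟩
    mulPS (mulPS (t^ a) (t^ b)) (addPS (mulPS (t^ a) g) (mulPS (t^ b) f))
      ≈⟨ mulPS-cong (t^-+ a b) (ser-+ y x) ⟨
    mulPS (t^ (a +ℕ b)) (ser (y + x)) ∎)

  +-assoc : ∀ x y z → (x + y) + z ≈ x + (y + z)
  +-assoc x@(⟨ a , f ⟩) y@(⟨ b , g ⟩) z@(⟨ c , h ⟩) = cross⇒≈ {(x + y) + z} {x + (y + z)} (begin
    mulPS (t^ (a +ℕ (b +ℕ c))) (ser ((x + y) + z))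
      ≈⟨ mulPS-cong (≗-trans (t^-+ a (b +ℕ c)) (mulPS-cong {f = t^ a} ≗-refl (t^-+ b c)))
           (≗-trans (ser-+ (x + y) z) (addPS-cong (mulPS-cong {f = t^ c} ≗-refl (ser-+ x y)) (mulPS-cong {g = h} (t^-+ a b) ≗-refl))) ⟩
    mulPS (mulPS (t^ a) (mulPS (t^ b) (t^ c))) (addPS (mulPS (t^ c) (addPS (mulPS (t^ b) f) (mulPS (t^ a) g))) (mulPS (mulPS (t^ a) (t^ b)) h))
      ≈⟨ solve 6 (λ A B C F G H → (A :* (B :* C)) :* (C :* (B :* F :+ A :* G) :+ (A :* B) :* H)
                                := ((A :* B) :* C) :* ((B :* C) :* F :+ A :* (C :* G :+ B :* H)))
           (λ _ → refl) (t^ a) (t^ b) (t^ c) f g h ⟩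
    mulPS (mulPS (mulPS (t^ a) (t^ b)) (t^ c)) (addPS (mulPS (mulPS (t^ b) (t^ c)) f) (mulPS (t^ a) (addPS (mulPS (t^ c) g) (mulPS (t^ b) h))))
      ≈⟨ mulPS-cong (≗-trans (t^-+ (a +ℕ b) c) (mulPS-cong {g = t^ c} (t^-+ a b) ≗-refl))
           (≗-trans (ser-+ x (y + z)) (addPS-cong (mulPS-cong {g = f} (t^-+ b c) ≗-refl) (mulPS-cong {f = t^ a} ≗-refl (ser-+ y z)))) ⟨
    mulPS (t^ ((a +ℕ b) +ℕ c)) (ser (x + (y + z))) ∎)

  +-identityˡ : ∀ x → 0K + x ≈ x
  +-identityˡ ⟨ a , f ⟩ = shiftPS-cong a (λ n → cong (_+₃ f n) (shiftPS-zero a n))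

  *-cong : ∀ {x x′ y y′} → x ≈ x′ → y ≈ y′ → x * y ≈ x′ * y′
  *-cong {x@(⟨ a , f ⟩)} {x′@(⟨ a′ , f′ ⟩)} {y@(⟨ b , g ⟩)} {y′@(⟨ b′ , g′ ⟩)} p q = cross⇒≈ {x * y} {x′ * y′} (begin
    mulPS (t^ (a′ +ℕ b′)) (mulPS f g)
      ≈⟨ mulPS-cong {g = mulPS f g} (t^-+ a′ b′) ≗-refl ⟩
    mulPS (mulPS (t^ a′) (t^ b′)) (mulPS f g)
      ≈⟨ solve 4 (λ A′ B′ F G → (A′ :* B′) :* (F :* G) := (A′ :* F) :* (B′ :* G)) (λ _ → refl) (t^ a′) (t^ b′) f g ⟩
    mulPS (mulPS (t^ a′) f) (mulPS (t^ b′) g)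
      ≈⟨ mulPS-cong (≈⇒cross {x} {x′} p) (≈⇒cross {y} {y′} q) ⟩
    mulPS (mulPS (t^ a) f′) (mulPS (t^ b) g′)
      ≈⟨ solve 4 (λ A B F G → (A :* F) :* (B :* G) := (A :* B) :* (F :* G)) (λ _ → refl) (t^ a) (t^ b) f′ g′ ⟩
    mulPS (mulPS (t^ a) (t^ b)) (mulPS f′ g′)
      ≈⟨ mulPS-cong {g = mulPS f′ g′} (t^-+ a b) ≗-refl ⟨
    mulPS (t^ (a +ℕ b)) (mulPS f′ g′) ∎)

  *-assoc : ∀ x y z → (x * y) * z ≈ x * (y * z)
  *-assoc ⟨ a , f ⟩ ⟨ b , g ⟩ ⟨ c , h ⟩ =
    ≗-trans (shiftPS-cong (a +ℕ (b +ℕ c)) (mulPS-assoc f g h)) (shiftPS-≡ (mulPS f (mulPS g h)) (sym (ℕ.+-assoc a b c)))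

  *-comm : ∀ x y → x * y ≈ y * x
  *-comm ⟨ a , f ⟩ ⟨ b , g ⟩ =
    ≗-trans (shiftPS-cong (b +ℕ a) (mulPS-comm f g)) (shiftPS-≡ (mulPS g f) (ℕ.+-comm b a))

  *-identityˡ : ∀ x → ι onePS * x ≈ x
  *-identityˡ ⟨ a , f ⟩ = shiftPS-cong a (mulPS-identityˡ f)

  *-zeroˡ : ∀ x → 0K * x ≈ 0K
  *-zeroˡ ⟨ a , f ⟩ n = trans (mulPS-zeroˡ f n) (sym (shiftPS-zero a n))

  *-distribˡ : ∀ x y z → x * (y + z) ≈ x * y + x * z
  *-distribˡ x@(⟨ a , f ⟩) y@(⟨ b , g ⟩) z@(⟨ c , h ⟩) = cross⇒≈ {x * (y + z)} {x * y + x * z} (begin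
    mulPS (t^ ((a +ℕ b) +ℕ (a +ℕ c))) (mulPS f (ser (y + z)))
      ≈⟨ mulPS-cong (≗-trans (t^-+ (a +ℕ b) (a +ℕ c)) (mulPS-cong (t^-+ a b) (t^-+ a c))) (mulPS-cong {f = f} ≗-refl (ser-+ y z)) ⟩
    mulPS (mulPS (mulPS (t^ a) (t^ b)) (mulPS (t^ a) (t^ c))) (mulPS f (addPS (mulPS (t^ c) g) (mulPS (t^ b) h)))
      ≈⟨ solve 6 (λ A B C F G H → ((A :* B) :* (A :* C)) :* (F :* (C :* G :+ B :* H))
                                := (A :* (B :* C)) :* ((A :* C) :* (F :* G) :+ (A :* B) :* (F :* H)))
           (λ _ → refl) (t^ a) (t^ b) (t^ c) f g h ⟩
    mulPS (mulPS (t^ a) (mulPS (t^ b) (t^ c))) (addPS (mulPS (mulPS (t^ a) (t^ c)) (mulPS f g)) (mulPS (mulPS (t^ a) (t^ b)) (mulPS f h)))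
      ≈⟨ mulPS-cong (≗-trans (t^-+ a (b +ℕ c)) (mulPS-cong {f = t^ a} ≗-refl (t^-+ b c)))
           (≗-trans (ser-+ (x * y) (x * z)) (addPS-cong (mulPS-cong {g = mulPS f g} (t^-+ a c) ≗-refl) (mulPS-cong {g = mulPS f h} (t^-+ a b) ≗-refl))) ⟨
    mulPS (t^ (a +ℕ (b +ℕ c))) (ser (x * y + x * z)) ∎)

  -‿cong : ∀ {x y} → x ≈ y → - x ≈ - y
  -‿cong {⟨ a , f ⟩} {⟨ b , g ⟩} p = ≗-trans (shiftPS-neg b f) (≗-trans (negPS-cong p) (≗-sym (shiftPS-neg a g)))

  -‿*-distribˡ : ∀ x y → (- x) * y ≈ - (x * y)
  -‿*-distribˡ ⟨ a , f ⟩ ⟨ b , g ⟩ = shiftPS-cong (a +ℕ b) (AlmostCommutativeRing.-‿*-distribˡ PS-ring f g)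

  -‿+-comm : ∀ x y → (- x) + (- y) ≈ - (x + y)
  -‿+-comm ⟨ a , f ⟩ ⟨ b , g ⟩ = shiftPS-cong (a +ℕ b) λ n →
    trans (cong₂ _+₃_ (shiftPS-neg b f n) (shiftPS-neg a g n)) (neg₃-+₃ (shiftPS b f n) (shiftPS a g n))

Kt-isCommutativeSemiring : IsCommutativeSemiring _≈_ _+_ _*_ 0K (ι onePS)
Kt-isCommutativeSemiring = record
  { isSemiring = record
    { isSemiringWithoutAnnihilatingZero = record
      { +-isCommutativeMonoid = record
        { isMonoid = record
          { isSemigroup = record
            { isMagma = record { isEquivalence = ≈-isEquivalence ; ∙-cong = λ {x} {x′} {y} {y′} → +-cong {x} {x′} {y} {y′} }
            ; assoc = +-assoc }
          ; identity = +-identityˡ , λ x → ≈-trans {x + 0K} {0K + x} {x} (+-comm x 0K) (+-identityˡ x) }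
        ; comm = +-comm }
      ; *-cong = λ {x} {x′} {y} {y′} → *-cong {x} {x′} {y} {y′}
      ; *-assoc = *-assoc
      ; *-identity = *-identityˡ , λ x → ≈-trans {x * ι onePS} {ι onePS * x} {x} (*-comm x (ι onePS)) (*-identityˡ x)
      ; distrib = *-distribˡ , λ x y z → begin
          (y + z) * x    ≈⟨ *-comm (y + z) x ⟩
          x * (y + z)    ≈⟨ *-distribˡ x y z ⟩
          x * y + x * z  ≈⟨ +-cong {x * y} {y * x} {x * z} {z * x} (*-comm x y) (*-comm x z) ⟩
          y * x + z * x  ∎ }
    ; zero = *-zeroˡ , λ x → ≈-trans {x * 0K} {0K * x} {0K} (*-comm x 0K) (*-zeroˡ x) }
  ; *-comm = *-comm }
  where open SetoidReasoning Kt-setoid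

Kt-ring : AlmostCommutativeRing _ _
Kt-ring = record
  { Carrier = Kt ; _≈_ = _≈_ ; _+_ = _+_ ; _*_ = _*_ ; -_ = -_ ; 0# = 0K ; 1# = ι onePS
  ; isAlmostCommutativeRing = record
    { isCommutativeSemiring = Kt-isCommutativeSemiring
    ; -‿cong = λ {x} {y} → -‿cong {x} {y}
    ; -‿*-distribˡ = -‿*-distribˡ
    ; -‿+-comm = -‿+-comm } }

ιconst : F3 → Kt
ιconst a = ι (constPS a)

ιconst-morphism : F3-rawRing -Raw-AlmostCommutative⟶ Kt-ring
ιconst-morphism = record
  { ⟦_⟧ = ιconst ; +-homo = +-homo ; *-homo = *-homo ; -‿homo = -‿homo ; 0-homo = 0-homo ; 1-homo = 1-homo }
  where open _-Raw-AlmostCommutative⟶_ constPS-morphism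

ιconst-≟ : ∀ a b → Maybe (ιconst a ≈ ιconst b)
ιconst-≟ a b with a ≟₃ b
... | yes refl = just (≈-refl {ιconst a})
... | no _     = nothing

module Kt-Solver = RingSolver F3-rawRing Kt-ring ιconst-morphism ιconst-≟
open Kt-Solver using (Polynomial; op; [+]; [*]; con; var; _:^_; :-_; ⟦_⟧; solve; _:=_; _:+_; _:*_; _:-_)

⟦⟧-cong : ∀ {n} (p : Polynomial n) {ρ ρ′ : Vec Kt n} → Pointwise _≈_ ρ ρ′ → ⟦ p ⟧ ρ ≈ ⟦ p ⟧ ρ′
⟦⟧-cong (op [+] p q) {ρ} {ρ′} ρ≈ρ′ =
  +-cong {⟦ p ⟧ ρ} {⟦ p ⟧ ρ′} {⟦ q ⟧ ρ} {⟦ q ⟧ ρ′} (⟦⟧-cong p ρ≈ρ′) (⟦⟧-cong q ρ≈ρ′)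
⟦⟧-cong (op [*] p q) {ρ} {ρ′} ρ≈ρ′ =
  *-cong {⟦ p ⟧ ρ} {⟦ p ⟧ ρ′} {⟦ q ⟧ ρ} {⟦ q ⟧ ρ′} (⟦⟧-cong p ρ≈ρ′) (⟦⟧-cong q ρ≈ρ′)
⟦⟧-cong (con c)      ρ≈ρ′ = ≈-refl {ιconst c}
⟦⟧-cong (var i)      ρ≈ρ′ = Pointwise.lookup ρ≈ρ′ i
⟦⟧-cong (p :^ k)     ρ≈ρ′ = Exp.^-congˡ (AlmostCommutativeRing.semiring Kt-ring) k (⟦⟧-cong p ρ≈ρ′)
⟦⟧-cong (:- p) {ρ} {ρ′} ρ≈ρ′ = -‿cong {⟦ p ⟧ ρ} {⟦ p ⟧ ρ′} (⟦⟧-cong p ρ≈ρ′)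

polynomials : ℕ → RawRing _ _
polynomials n = record
  { Carrier = Polynomial n ; _≈_ = _≡_ ; _+_ = _:+_ ; _*_ = _:*_ ; -_ = :-_ ; 0# = con f0 ; 1# = con f1 }

module Poly {n : ℕ} = Forms (polynomials n)
open Forms (AlmostCommutativeRing.rawRing Kt-ring) tK hiding (_-_)

≈0K⇒≗0 : ∀ x → x ≈ 0K → ser x ≗ zeroPS
≈0K⇒≗0 x p n = trans (p n) (shiftPS-zero (s x) n)

≗0⇒≈0K : ∀ x → ser x ≗ zeroPS → x ≈ 0K
≗0⇒≈0K x p n = trans (p n) (sym (shiftPS-zero (s x) n))

x*y≈0⇒y≈0 : ∀ x y → ¬ x ≈ 0K → x * y ≈ 0K → y ≈ 0K
x*y≈0⇒y≈0 x y x≉0 xy≈0 = ≗0⇒≈0K y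
  (mulPS-cancel-zero (ser x) (ser y) (x≉0 ∘ ≗0⇒≈0K x) (≈0K⇒≗0 (x * y) xy≈0))

tK≉0 : ¬ tK ≈ 0K
tK≉0 p = f1≢f0 (p 1)

t^-at : ∀ k → (t^ k) k ≡ f1
t^-at zero    = refl
t^-at (suc k) = t^-at k

t^≉0 : ∀ k → ¬ ι (t^ k) ≈ 0K
t^≉0 k p = f1≢f0 (trans (sym (t^-at k)) (p k))

ι≈t*ι-tail : ∀ f → f 0 ≡ f0 → ι f ≈ tK * ι (tailPS f)
ι≈t*ι-tail f f₀≡0 zero    = f₀≡0
ι≈t*ι-tail f f₀≡0 (suc k) = sym (trans (mulPS-suc (ser tK) (tailPS f) k)
  (trans (mulPS-cong {g = tailPS f} tail-t≗1 ≗-refl k) (mulPS-identityˡ (tailPS f) k)))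
  where
  tail-t≗1 : tailPS (ser tK) ≗ onePS
  tail-t≗1 zero    = refl
  tail-t≗1 (suc _) = refl

clear-denominator : ∀ {k} x → s x ≤ k → ι (t^ k) * x ≈ ι (shiftPS (k ∸ s x) (ser x))
clear-denominator {k} x sx≤k = begin
  mulPS (t^ k) (ser x)                          ≈⟨ shiftPS≗t^* k (ser x) ⟨
  shiftPS k (ser x)                             ≈⟨ shiftPS-≡ (ser x) (ℕ.m+[n∸m]≡n sx≤k) ⟨
  shiftPS (s x +ℕ (k ∸ s x)) (ser x)            ≈⟨ shiftPS-+ (s x) (k ∸ s x) (ser x) ⟩
  shiftPS (s x) (shiftPS (k ∸ s x) (ser x))     ∎
  where open SetoidReasoning PS-setoid

denominator : ∀ {n} → (Fin n → Kt) → ℕ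
denominator {zero}  x = 0
denominator {suc n} x = s (x fzero) +ℕ denominator (x ∘ fsuc)

s≤denominator : ∀ {n} (x : Fin n → Kt) i → s (x i) ≤ denominator x
s≤denominator x fzero    = ℕ.m≤m+n (s (x fzero)) _
s≤denominator x (fsuc i) = ℕ.≤-trans (s≤denominator (x ∘ fsuc) i) (ℕ.m≤n+m _ (s (x fzero)))

0K≈ιconst0 : 0K ≈ ιconst f0
0K≈ιconst0 zero    = refl
0K≈ιconst0 (suc _) = refl

x≈y⇒x-y≈0 : ∀ x y → x ≈ y → x - y ≈ 0K
x≈y⇒x-y≈0 x y x≈y = begin
  x - y           ≈⟨ +-cong {x} {y} { - y} { - y} x≈y (≈-refl { - y}) ⟩
  y - y           ≈⟨ solve 1 (λ y → y :- y := con f0) (λ _ → refl) y ⟩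
  ιconst f0       ≈⟨ 0K≈ιconst0 ⟨
  0K              ∎
  where open SetoidReasoning Kt-setoid

-x≈0⇒x≈0 : ∀ x → - x ≈ 0K → x ≈ 0K
-x≈0⇒x≈0 x -x≈0 = begin
  x        ≈⟨ solve 1 (λ x → x := :- (:- x)) (λ _ → refl) x ⟩
  - (- x)  ≈⟨ -‿cong { - x} {0K} -x≈0 ⟩
  - 0K     ≈⟨ (λ _ → refl) ⟩
  0K       ∎
  where open SetoidReasoning Kt-setoid

-- Anisotropy by descent

record IsHomogeneousQuadratic {n} (F : (Fin n → Kt) → Kt) : Set where
  field
    congruent   : ∀ {x y} → (∀ i → x i ≈ y i) → F x ≈ F y
    homogeneous : ∀ c x → F (λ i → c * x i) ≈ (c * c) * F x

Anisotropic : ∀ {n} → ((Fin n → Kt) → Kt) → Set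
Anisotropic F = ∀ x → F x ≈ 0K → ∀ i → x i ≈ 0K

module _ {n} {F : (Fin n → Kt) → Kt} (F-quadratic : IsHomogeneousQuadratic F) where
  open IsHomogeneousQuadratic F-quadratic
  open SetoidReasoning Kt-setoid

  scaled-zero : ∀ c x → F x ≈ 0K → F (λ i → c * x i) ≈ 0K
  scaled-zero c x Fx≈0 = begin
    F (λ i → c * x i) ≈⟨ homogeneous c x ⟩
    (c * c) * F x     ≈⟨ *-cong {c * c} {c * c} {F x} {0K} (≈-refl {c * c}) Fx≈0 ⟩
    (c * c) * 0K      ≈⟨ *-comm (c * c) 0K ⟩
    0K * (c * c)      ≈⟨ *-zeroˡ (c * c) ⟩
    0K                ∎

  unscaled-zero : ∀ c x → ¬ c ≈ 0K → F (λ i → c * x i) ≈ 0K → F x ≈ 0K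
  unscaled-zero c x c≉0 Fcx≈0 = x*y≈0⇒y≈0 (c * c) (F x) c²≉0 (begin
    (c * c) * F x     ≈⟨ homogeneous c x ⟨
    F (λ i → c * x i) ≈⟨ Fcx≈0 ⟩
    0K                ∎)
    where
    c²≉0 : ¬ c * c ≈ 0K
    c²≉0 c²≈0 = c≉0 (x*y≈0⇒y≈0 c c c≉0 c²≈0)

  integral-zeros-vanish : (∀ X → F (ι ∘ X) ≈ 0K → ∀ i → X i 0 ≡ f0) →
                          ∀ X → F (ι ∘ X) ≈ 0K → ∀ i → X i ≗ zeroPS
  integral-zeros-vanish reduction X FX≈0 i zero    = reduction X FX≈0 i
  integral-zeros-vanish reduction X FX≈0 i (suc k) =
    integral-zeros-vanish reduction (tailPS ∘ X) (unscaled-zero tK (ι ∘ tailPS ∘ X) tK≉0 (begin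
      F (λ j → tK * ι (tailPS (X j))) ≈⟨ congruent (λ j → ι≈t*ι-tail (X j) (reduction X FX≈0 j)) ⟨
      F (ι ∘ X)                      ≈⟨ FX≈0 ⟩
      0K                             ∎)) i k

  anisotropic-by-descent : (∀ X → F (ι ∘ X) ≈ 0K → ∀ i → X i 0 ≡ f0) → Anisotropic F
  anisotropic-by-descent reduction x Fx≈0 i = x*y≈0⇒y≈0 c (x i) (t^≉0 K) (begin
    c * x i   ≈⟨ cx≈ιX i ⟩
    ι (X i)   ≈⟨ integral-zeros-vanish reduction X FιX≈0 i ⟩
    0K        ∎)
    where
    K : ℕ
    K = denominator x
    c : Kt
    c = ι (t^ K)
    X : Fin n → PS
    X j = shiftPS (K ∸ s (x j)) (ser (x j))
    cx≈ιX : ∀ j → c * x j ≈ ι (X j)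
    cx≈ιX j = clear-denominator (x j) (s≤denominator x j)
    FιX≈0 : F (ι ∘ X) ≈ 0K
    FιX≈0 = begin
      F (ι ∘ X)          ≈⟨ congruent cx≈ιX ⟨
      F (λ j → c * x j)  ≈⟨ scaled-zero c x Fx≈0 ⟩
      0K                 ∎

P-cong : ∀ b {x₂ x₃ x₄ y₂ y₃ y₄} → x₂ ≈ y₂ → x₃ ≈ y₃ → x₄ ≈ y₄ → P b x₂ x₃ x₄ ≈ P b y₂ y₃ y₄
P-cong b {x₂} {x₃} {x₄} {y₂} {y₃} {y₄} p₂ p₃ p₄ =
  ⟦⟧-cong (Poly.P (var (# 0)) (var (# 1)) (var (# 2)) (var (# 3)) (var (# 4)))
    {tK ∷ b ∷ x₂ ∷ x₃ ∷ x₄ ∷ []} {tK ∷ b ∷ y₂ ∷ y₃ ∷ y₄ ∷ []} (≈-refl {tK} ∷ ≈-refl {b} ∷ p₂ ∷ p₃ ∷ p₄ ∷ [])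

P-homogeneous : ∀ b c x₂ x₃ x₄ → P b (c * x₂) (c * x₃) (c * x₄) ≈ (c * c) * P b x₂ x₃ x₄
P-homogeneous b c x₂ x₃ x₄ = solve 6
  (λ t b c x₂ x₃ x₄ → Poly.P t b (c :* x₂) (c :* x₃) (c :* x₄) := (c :* c) :* Poly.P t b x₂ x₃ x₄)
  (λ _ → refl) tK b c x₂ x₃ x₄

P₃ : PS → (Fin 3 → Kt) → Kt
P₃ b x = P (ι b) (x (# 0)) (x (# 1)) (x (# 2))

P₃-quadratic : ∀ b → IsHomogeneousQuadratic (P₃ b)
P₃-quadratic b = record
  { congruent   = λ {x} {y} p →
      P-cong (ι b) {x (# 0)} {x (# 1)} {x (# 2)} {y (# 0)} {y (# 1)} {y (# 2)} (p (# 0)) (p (# 1)) (p (# 2))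
  ; homogeneous = λ c x → P-homogeneous (ι b) c (x (# 0)) (x (# 1)) (x (# 2)) }

P-factor : ∀ b x₂ x₃ x₄ → P b (tK * x₂) x₃ (tK * x₄) ≈ tK * P′ b x₂ x₃ x₄
P-factor b x₂ x₃ x₄ = solve 5
  (λ t b x₂ x₃ x₄ → Poly.P t b (t :* x₂) x₃ (t :* x₄) := t :* Poly.P′ t b x₂ x₃ x₄)
  (λ _ → refl) tK b x₂ x₃ x₄

-- Modulo t, P is x₄² − x₂x₄ − x₂², anisotropic over F₃ since 5 is not a square mod 3.
-- The constant term of P(…) computes from the constant terms alone, so a check over F₃ suffices.
P-mod-t : ∀ b x₂ x₃ x₄ → ser (P (ι b) (ι x₂) (ι x₃) (ι x₄)) 0 ≡ f0 → x₂ 0 ≡ f0 × x₄ 0 ≡ f0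
P-mod-t b x₂ x₃ x₄ = by-cases (b 0) (x₂ 0) (x₃ 0) (x₄ 0)
  where
  by-cases : ∀ b x₂ x₃ x₄ → ser (P (ιconst b) (ιconst x₂) (ιconst x₃) (ιconst x₄)) 0 ≡ f0 → x₂ ≡ f0 × x₄ ≡ f0
  by-cases = from-yes (∀₃? λ b → ∀₃? λ x₂ → ∀₃? λ x₃ → ∀₃? λ x₄ →
    ser (P (ιconst b) (ιconst x₂) (ιconst x₃) (ιconst x₄)) 0 ≟₃ f0 →-dec x₂ ≟₃ f0 ×-dec x₄ ≟₃ f0)

-- Modulo t, P′ is x₃².
P′-mod-t : ∀ b x₂ x₃ x₄ → ser (P′ (ι b) (ι x₂) (ι x₃) (ι x₄)) 0 ≡ f0 → x₃ 0 ≡ f0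
P′-mod-t b x₂ x₃ x₄ = by-cases (b 0) (x₂ 0) (x₃ 0) (x₄ 0)
  where
  by-cases : ∀ b x₂ x₃ x₄ → ser (P′ (ιconst b) (ιconst x₂) (ιconst x₃) (ιconst x₄)) 0 ≡ f0 → x₃ ≡ f0
  by-cases = from-yes (∀₃? λ b → ∀₃? λ x₂ → ∀₃? λ x₃ → ∀₃? λ x₄ →
    ser (P′ (ιconst b) (ιconst x₂) (ιconst x₃) (ιconst x₄)) 0 ≟₃ f0 →-dec x₃ ≟₃ f0)

P-reduction : ∀ b X → P₃ b (ι ∘ X) ≈ 0K → ∀ i → X i 0 ≡ f0
P-reduction b X P≈0 = λ where
    fzero               → proj₁ x₂x₄≡0
    (fsuc fzero)        → P′-mod-t b x₂′ x₃ x₄′ (P′≈0 0)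
    (fsuc (fsuc fzero)) → proj₂ x₂x₄≡0
  where
  open SetoidReasoning Kt-setoid
  x₂ x₃ x₄ x₂′ x₄′ : PS
  x₂  = X (# 0)
  x₃  = X (# 1)
  x₄  = X (# 2)
  x₂′ = tailPS x₂
  x₄′ = tailPS x₄
  x₂x₄≡0 : x₂ 0 ≡ f0 × x₄ 0 ≡ f0
  x₂x₄≡0 = P-mod-t b x₂ x₃ x₄ (P≈0 0)
  P′≈0 : P′ (ι b) (ι x₂′) (ι x₃) (ι x₄′) ≈ 0K
  P′≈0 = x*y≈0⇒y≈0 tK (P′ (ι b) (ι x₂′) (ι x₃) (ι x₄′)) tK≉0 (begin
    tK * P′ (ι b) (ι x₂′) (ι x₃) (ι x₄′)
      ≈⟨ P-factor (ι b) (ι x₂′) (ι x₃) (ι x₄′) ⟨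
    P (ι b) (tK * ι x₂′) (ι x₃) (tK * ι x₄′)
      ≈⟨ P-cong (ι b) {ι x₂} {ι x₃} {ι x₄} {tK * ι x₂′} {ι x₃} {tK * ι x₄′}
           (ι≈t*ι-tail x₂ (proj₁ x₂x₄≡0)) (≈-refl {ι x₃}) (ι≈t*ι-tail x₄ (proj₂ x₂x₄≡0)) ⟨
    P (ι b) (ι x₂) (ι x₃) (ι x₄)
      ≈⟨ P≈0 ⟩
    0K ∎)

P-anisotropic : ∀ b → Anisotropic (P₃ b)
P-anisotropic b = anisotropic-by-descent (P₃-quadratic b) (P-reduction b)

G-cong : ∀ b {z₂ z₃ z₄ e y₂ y₃ y₄ e′} → z₂ ≈ y₂ → z₃ ≈ y₃ → z₄ ≈ y₄ → e ≈ e′ → G b z₂ z₃ z₄ e ≈ G b y₂ y₃ y₄ e′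
G-cong b {z₂} {z₃} {z₄} {e} {y₂} {y₃} {y₄} {e′} p₂ p₃ p₄ pₑ =
  ⟦⟧-cong (Poly.G (var (# 0)) (var (# 1)) (var (# 2)) (var (# 3)) (var (# 4)) (var (# 5)))
    {tK ∷ b ∷ z₂ ∷ z₃ ∷ z₄ ∷ e ∷ []} {tK ∷ b ∷ y₂ ∷ y₃ ∷ y₄ ∷ e′ ∷ []} (≈-refl {tK} ∷ ≈-refl {b} ∷ p₂ ∷ p₃ ∷ p₄ ∷ pₑ ∷ [])

G-homogeneous : ∀ b c z₂ z₃ z₄ e → G b (c * z₂) (c * z₃) (c * z₄) (c * e) ≈ (c * c) * G b z₂ z₃ z₄ e
G-homogeneous b c z₂ z₃ z₄ e = solve 7
  (λ t b c z₂ z₃ z₄ e → Poly.G t b (c :* z₂) (c :* z₃) (c :* z₄) (c :* e) := (c :* c) :* Poly.G t b z₂ z₃ z₄ e)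
  (λ _ → refl) tK b c z₂ z₃ z₄ e

G₄ : PS → (Fin 4 → Kt) → Kt
G₄ b z = G (ι b) (z (# 0)) (z (# 1)) (z (# 2)) (z (# 3))

G₄-quadratic : ∀ b → IsHomogeneousQuadratic (G₄ b)
G₄-quadratic b = record
  { congruent   = λ {z} {y} p → G-cong (ι b) {z (# 0)} {z (# 1)} {z (# 2)} {z (# 3)} {y (# 0)} {y (# 1)} {y (# 2)} {y (# 3)}
      (p (# 0)) (p (# 1)) (p (# 2)) (p (# 3))
  ; homogeneous = λ c z → G-homogeneous (ι b) c (z (# 0)) (z (# 1)) (z (# 2)) (z (# 3)) }

G-factor : ∀ b z₂ z₃ z₄ e → G b z₂ (tK * z₃) z₄ (tK * e) ≈ tK * G′ b z₂ z₃ z₄ e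
G-factor b z₂ z₃ z₄ e = solve 6
  (λ t b z₂ z₃ z₄ e → Poly.G t b z₂ (t :* z₃) z₄ (t :* e) := t :* Poly.G′ t b z₂ z₃ z₄ e)
  (λ _ → refl) tK b z₂ z₃ z₄ e

-- Modulo t, G is −z₃² − e², anisotropic over F₃ since −1 is not a square mod 3.
G-mod-t : ∀ b z₂ z₃ z₄ e → ser (G (ι b) (ι z₂) (ι z₃) (ι z₄) (ι e)) 0 ≡ f0 → z₃ 0 ≡ f0 × e 0 ≡ f0
G-mod-t b z₂ z₃ z₄ e = by-cases (b 0) (z₂ 0) (z₃ 0) (z₄ 0) (e 0)
  where
  by-cases : ∀ b z₂ z₃ z₄ e → ser (G (ιconst b) (ιconst z₂) (ιconst z₃) (ιconst z₄) (ιconst e)) 0 ≡ f0 → z₃ ≡ f0 × e ≡ f0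
  by-cases = from-yes (∀₃? λ b → ∀₃? λ z₂ → ∀₃? λ z₃ → ∀₃? λ z₄ → ∀₃? λ e →
    ser (G (ιconst b) (ιconst z₂) (ιconst z₃) (ιconst z₄) (ιconst e)) 0 ≟₃ f0 →-dec z₃ ≟₃ f0 ×-dec e ≟₃ f0)

-- Modulo t, G′ is z₄² − z₂z₄ − z₂².
G′-mod-t : ∀ b z₂ z₃ z₄ e → ser (G′ (ι b) (ι z₂) (ι z₃) (ι z₄) (ι e)) 0 ≡ f0 → z₂ 0 ≡ f0 × z₄ 0 ≡ f0
G′-mod-t b z₂ z₃ z₄ e = by-cases (b 0) (z₂ 0) (z₃ 0) (z₄ 0) (e 0)
  where
  by-cases : ∀ b z₂ z₃ z₄ e → ser (G′ (ιconst b) (ιconst z₂) (ιconst z₃) (ιconst z₄) (ιconst e)) 0 ≡ f0 → z₂ ≡ f0 × z₄ ≡ f0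
  by-cases = from-yes (∀₃? λ b → ∀₃? λ z₂ → ∀₃? λ z₃ → ∀₃? λ z₄ → ∀₃? λ e →
    ser (G′ (ιconst b) (ιconst z₂) (ιconst z₃) (ιconst z₄) (ιconst e)) 0 ≟₃ f0 →-dec z₂ ≟₃ f0 ×-dec z₄ ≟₃ f0)

G-reduction : ∀ b Z → G₄ b (ι ∘ Z) ≈ 0K → ∀ i → Z i 0 ≡ f0
G-reduction b Z G≈0 = λ where
    fzero                      → proj₁ z₂z₄≡0
    (fsuc fzero)               → proj₁ z₃e≡0
    (fsuc (fsuc fzero))        → proj₂ z₂z₄≡0
    (fsuc (fsuc (fsuc fzero))) → proj₂ z₃e≡0
  where
  open SetoidReasoning Kt-setoid
  z₂ z₃ z₄ e z₃′ e′ : PS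
  z₂  = Z (# 0)
  z₃  = Z (# 1)
  z₄  = Z (# 2)
  e   = Z (# 3)
  z₃′ = tailPS z₃
  e′  = tailPS e
  z₃e≡0 : z₃ 0 ≡ f0 × e 0 ≡ f0
  z₃e≡0 = G-mod-t b z₂ z₃ z₄ e (G≈0 0)
  G′≈0 : G′ (ι b) (ι z₂) (ι z₃′) (ι z₄) (ι e′) ≈ 0K
  G′≈0 = x*y≈0⇒y≈0 tK (G′ (ι b) (ι z₂) (ι z₃′) (ι z₄) (ι e′)) tK≉0 (begin
    tK * G′ (ι b) (ι z₂) (ι z₃′) (ι z₄) (ι e′)
      ≈⟨ G-factor (ι b) (ι z₂) (ι z₃′) (ι z₄) (ι e′) ⟨
    G (ι b) (ι z₂) (tK * ι z₃′) (ι z₄) (tK * ι e′)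
      ≈⟨ G-cong (ι b) {ι z₂} {ι z₃} {ι z₄} {ι e} {ι z₂} {tK * ι z₃′} {ι z₄} {tK * ι e′}
           (≈-refl {ι z₂}) (ι≈t*ι-tail z₃ (proj₁ z₃e≡0)) (≈-refl {ι z₄}) (ι≈t*ι-tail e (proj₂ z₃e≡0)) ⟨
    G (ι b) (ι z₂) (ι z₃) (ι z₄) (ι e)
      ≈⟨ G≈0 ⟩
    0K ∎)
  z₂z₄≡0 : z₂ 0 ≡ f0 × z₄ 0 ≡ f0
  z₂z₄≡0 = G′-mod-t b z₂ z₃′ z₄ e′ (G′≈0 0)

G-anisotropic : ∀ b → Anisotropic (G₄ b)
G-anisotropic b = anisotropic-by-descent (G₄-quadratic b) (G-reduction b)

Qb-cong : ∀ d b {u u′ : Vec5} → (∀ i → u i ≈ u′ i) → Qb d b u ≈ Qb d b u′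
Qb-cong d b {u} {u′} p =
  ⟦⟧-cong (Poly.Q (var (# 0)) (var (# 1)) (var (# 2)) (var (# 3)) (var (# 4)) (var (# 5)) (var (# 6)) (var (# 7)))
    {tK ∷ b ∷ d ∷ u0 u ∷ u1 u ∷ u2 u ∷ u3 u ∷ u4 u ∷ []} {tK ∷ b ∷ d ∷ u0 u′ ∷ u1 u′ ∷ u2 u′ ∷ u3 u′ ∷ u4 u′ ∷ []}
    (≈-refl {tK} ∷ ≈-refl {b} ∷ ≈-refl {d} ∷ p (# 0) ∷ p (# 1) ∷ p (# 2) ∷ p (# 3) ∷ p (# 4) ∷ [])

Q-split : ∀ b d u₀ u₁ u₂ u₃ u₄ → Q b d u₀ u₁ u₂ u₃ u₄ ≈ H b d u₀ u₁ + P b u₂ u₃ u₄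
Q-split b d u₀ u₁ u₂ u₃ u₄ = solve 8
  (λ t b d u₀ u₁ u₂ u₃ u₄ → Poly.Q t b d u₀ u₁ u₂ u₃ u₄ := Poly.H t b d u₀ u₁ :+ Poly.P t b u₂ u₃ u₄)
  (λ _ → refl) tK b d u₀ u₁ u₂ u₃ u₄

disc-cong : ∀ {h₁ h₂ h₃ q₁ q₂ q₃} → h₁ ≈ q₁ → h₂ ≈ q₂ → h₃ ≈ q₃ → disc h₁ h₂ h₃ ≈ disc q₁ q₂ q₃
disc-cong {h₁} {h₂} {h₃} {q₁} {q₂} {q₃} p₁ p₂ p₃ =
  ⟦⟧-cong (Poly.disc (var (# 0)) (var (# 1)) (var (# 2)) (var (# 3)))
    {tK ∷ h₁ ∷ h₂ ∷ h₃ ∷ []} {tK ∷ q₁ ∷ q₂ ∷ q₃ ∷ []} (≈-refl {tK} ∷ p₁ ∷ p₂ ∷ p₃ ∷ [])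

disc-opposite : ∀ h₁ h₂ h₃ q₁ q₂ q₃ → h₁ + q₁ ≈ 0K → h₂ + q₂ ≈ 0K → h₃ + q₃ ≈ 0K → disc h₁ h₂ h₃ ≈ disc q₁ q₂ q₃
disc-opposite h₁ h₂ h₃ q₁ q₂ q₃ p₁ p₂ p₃ = begin
  disc h₁ h₂ h₃
    ≈⟨ solve 7 (λ t h₁ h₂ h₃ q₁ q₂ q₃ → Poly.disc t h₁ h₂ h₃ := Poly.disc t (h₁ :+ q₁ :- q₁) (h₂ :+ q₂ :- q₂) (h₃ :+ q₃ :- q₃))
         (λ _ → refl) tK h₁ h₂ h₃ q₁ q₂ q₃ ⟩
  disc (h₁ + q₁ - q₁) (h₂ + q₂ - q₂) (h₃ + q₃ - q₃)
    ≈⟨ disc-cong {h₁ + q₁ - q₁} {h₂ + q₂ - q₂} {h₃ + q₃ - q₃} {ιconst f0 - q₁} {ιconst f0 - q₂} {ιconst f0 - q₃}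
         (minus (h₁ + q₁) q₁ p₁) (minus (h₂ + q₂) q₂ p₂) (minus (h₃ + q₃) q₃ p₃) ⟩
  disc (ιconst f0 - q₁) (ιconst f0 - q₂) (ιconst f0 - q₃)
    ≈⟨ solve 4 (λ t q₁ q₂ q₃ → Poly.disc t (con f0 :- q₁) (con f0 :- q₂) (con f0 :- q₃) := Poly.disc t q₁ q₂ q₃)
         (λ _ → refl) tK q₁ q₂ q₃ ⟩
  disc q₁ q₂ q₃ ∎
  where
  open SetoidReasoning Kt-setoid
  minus : ∀ x y → x ≈ 0K → x - y ≈ ιconst f0 - y
  minus x y x≈0 = +-cong {x} {ιconst f0} { - y} { - y} (≈-trans {x} {0K} {ιconst f0} x≈0 0K≈ιconst0) (≈-refl { - y})

disc-H : ∀ b d v₀ v₁ w₀ w₁ →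
  disc (H b d v₀ v₁) (H b d w₀ w₁) (H b d (v₀ + w₀) (v₁ + w₁)) ≈ ((v₀ * w₁ - v₁ * w₀) * d) * ((v₀ * w₁ - v₁ * w₀) * d) * U b
disc-H b d v₀ v₁ w₀ w₁ = solve 7
  (λ t b d v₀ v₁ w₀ w₁ → Poly.disc t (Poly.H t b d v₀ v₁) (Poly.H t b d w₀ w₁) (Poly.H t b d (v₀ :+ w₀) (v₁ :+ w₁))
    := ((v₀ :* w₁ :- v₁ :* w₀) :* d) :* ((v₀ :* w₁ :- v₁ :* w₀) :* d) :* Poly.U t b)
  (λ _ → refl) tK b d v₀ v₁ w₀ w₁

disc-P : ∀ b x₂ x₃ x₄ y₂ y₃ y₄ →
  disc (P b x₂ x₃ x₄) (P b y₂ y₃ y₄) (P b (x₂ + y₂) (x₃ + y₃) (x₄ + y₄))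
    ≈ adjP b (x₃ * y₄ - x₄ * y₃) (x₄ * y₂ - x₂ * y₄) (x₂ * y₃ - x₃ * y₂)
disc-P b x₂ x₃ x₄ y₂ y₃ y₄ = solve 8
  (λ t b x₂ x₃ x₄ y₂ y₃ y₄ → Poly.disc t (Poly.P t b x₂ x₃ x₄) (Poly.P t b y₂ y₃ y₄) (Poly.P t b (x₂ :+ y₂) (x₃ :+ y₃) (x₄ :+ y₄))
    := Poly.adjP t b (x₃ :* y₄ :- x₄ :* y₃) (x₄ :* y₂ :- x₂ :* y₄) (x₂ :* y₃ :- x₃ :* y₂))
  (λ _ → refl) tK b x₂ x₃ x₄ y₂ y₃ y₄

module LineOnQuadric (d : Kt) (b : PS) (v w : Vec5) (on-line : ∀ a c → Qb d (ι b) (lin a v c w) ≈ 0K) where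
  open SetoidReasoning Kt-setoid

  B : Kt
  B = ι b

  H+P≈0 : ∀ a c (u : Vec5) → (∀ i → u i ≈ lin a v c w i) → H B d (u0 u) (u1 u) + P B (u2 u) (u3 u) (u4 u) ≈ 0K
  H+P≈0 a c u u≈x = begin
    H B d (u0 u) (u1 u) + P B (u2 u) (u3 u) (u4 u) ≈⟨ Q-split B d (u0 u) (u1 u) (u2 u) (u3 u) (u4 u) ⟨
    Qb d B u                                        ≈⟨ Qb-cong d B {u} {lin a v c w} u≈x ⟩
    Qb d B (lin a v c w)                            ≈⟨ on-line a c ⟩
    0K                                              ∎

  Δ : Kt
  Δ = v (# 0) * w (# 1) - v (# 1) * w (# 0)

  Hv Hw Hs Pv Pw Ps : Kt
  Hv = H B d (v (# 0)) (v (# 1))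
  Hw = H B d (w (# 0)) (w (# 1))
  Hs = H B d (v (# 0) + w (# 0)) (v (# 1) + w (# 1))
  Pv = P B (v (# 2)) (v (# 3)) (v (# 4))
  Pw = P B (w (# 2)) (w (# 3)) (w (# 4))
  Ps = P B (v (# 2) + w (# 2)) (v (# 3) + w (# 3)) (v (# 4) + w (# 4))

  v-on-line : ∀ i → v i ≈ lin (ιconst f1) v (ιconst f0) w i
  v-on-line i = solve 2 (λ x y → x := con f1 :* x :+ con f0 :* y) (λ _ → refl) (v i) (w i)

  Hv+Pv≈0 : Hv + Pv ≈ 0K
  Hv+Pv≈0 = H+P≈0 (ιconst f1) (ιconst f0) v v-on-line

  Hw+Pw≈0 : Hw + Pw ≈ 0K
  Hw+Pw≈0 = H+P≈0 (ιconst f0) (ιconst f1) w λ i →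
    solve 2 (λ x y → y := con f0 :* x :+ con f1 :* y) (λ _ → refl) (v i) (w i)

  Hs+Ps≈0 : Hs + Ps ≈ 0K
  Hs+Ps≈0 = H+P≈0 (ιconst f1) (ιconst f1) (λ i → v i + w i) λ i →
    solve 2 (λ x y → x :+ y := con f1 :* x :+ con f1 :* y) (λ _ → refl) (v i) (w i)

  determinant-vanishes : ¬ d ≈ 0K → Δ ≈ 0K
  determinant-vanishes d≉0 = x*y≈0⇒y≈0 d Δ d≉0 (begin
    d * Δ  ≈⟨ *-comm d Δ ⟩
    Δ * d  ≈⟨ G-anisotropic b z Gz≈0 (# 3) ⟩
    0K     ∎)
    where
    z : Fin 4 → Kt
    z fzero                      = v (# 3) * w (# 4) - v (# 4) * w (# 3)
    z (fsuc fzero)               = v (# 4) * w (# 2) - v (# 2) * w (# 4)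
    z (fsuc (fsuc fzero))        = v (# 2) * w (# 3) - v (# 3) * w (# 2)
    z (fsuc (fsuc (fsuc fzero))) = Δ * d
    Gz≈0 : G₄ b z ≈ 0K
    Gz≈0 = x≈y⇒x-y≈0 (adjP B (z (# 0)) (z (# 1)) (z (# 2))) ((Δ * d) * (Δ * d) * U B) (begin
      adjP B (z (# 0)) (z (# 1)) (z (# 2)) ≈⟨ disc-P B (v (# 2)) (v (# 3)) (v (# 4)) (w (# 2)) (w (# 3)) (w (# 4)) ⟨
      disc Pv Pw Ps                        ≈⟨ disc-opposite Hv Hw Hs Pv Pw Ps Hv+Pv≈0 Hw+Pw≈0 Hs+Ps≈0 ⟨
      disc Hv Hw Hs                        ≈⟨ disc-H B d (v (# 0)) (v (# 1)) (w (# 0)) (w (# 1)) ⟩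
      (Δ * d) * (Δ * d) * U B              ∎)

  u₀,u₁≈0⇒trivial : LinIndep v w → ∀ a c → lin a v c w (# 0) ≈ 0K → lin a v c w (# 1) ≈ 0K → a ≈ 0K × c ≈ 0K
  u₀,u₁≈0⇒trivial independent a c x₀≈0 x₁≈0 = independent a c λ where
      fzero           → x₀≈0
      (fsuc fzero)    → x₁≈0
      (fsuc (fsuc i)) → P-anisotropic b (x ∘ fsuc ∘ fsuc) Px≈0 i
    where
    x x′ : Vec5
    x = lin a v c w
    x′ fzero           = ιconst f0
    x′ (fsuc fzero)    = ιconst f0
    x′ (fsuc (fsuc i)) = x (fsuc (fsuc i))
    x′≈x : ∀ i → x′ i ≈ x i
    x′≈x fzero           = ≈-sym {x (# 0)} {ιconst f0} (≈-trans {x (# 0)} {0K} {ιconst f0} x₀≈0 0K≈ιconst0)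
    x′≈x (fsuc fzero)    = ≈-sym {x (# 1)} {ιconst f0} (≈-trans {x (# 1)} {0K} {ιconst f0} x₁≈0 0K≈ιconst0)
    x′≈x (fsuc (fsuc i)) = ≈-refl {x (fsuc (fsuc i))}
    Px≈0 : P B (x (# 2)) (x (# 3)) (x (# 4)) ≈ 0K
    Px≈0 = begin
      P B (x (# 2)) (x (# 3)) (x (# 4))
        ≈⟨ solve 6 (λ t b d x₂ x₃ x₄ → Poly.P t b x₂ x₃ x₄ := Poly.Q t b d (con f0) (con f0) x₂ x₃ x₄)
             (λ _ → refl) tK B d (x (# 2)) (x (# 3)) (x (# 4)) ⟩
      Qb d B x′  ≈⟨ Qb-cong d B {x′} {x} x′≈x ⟩
      Qb d B x   ≈⟨ on-line a c ⟩
      0K         ∎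

  first-coordinates-vanish : LinIndep v w → Δ ≈ 0K → v (# 0) ≈ 0K × v (# 1) ≈ 0K
  first-coordinates-vanish independent Δ≈0 = -x≈0⇒x≈0 v₀ (proj₂ column₀) , -x≈0⇒x≈0 v₁ (proj₂ column₁)
    where
    -- The combination w_i v − v_i w has i-th coordinate 0 and the other one ±Δ.
    v₀ v₁ w₀ w₁ : Kt
    v₀ = v (# 0)
    v₁ = v (# 1)
    w₀ = w (# 0)
    w₁ = w (# 1)
    column₀ : w₀ ≈ 0K × - v₀ ≈ 0K
    column₀ = u₀,u₁≈0⇒trivial independent w₀ (- v₀)
      (begin
        w₀ * v₀ + - v₀ * w₀  ≈⟨ solve 2 (λ v₀ w₀ → w₀ :* v₀ :+ :- v₀ :* w₀ := con f0) (λ _ → refl) v₀ w₀ ⟩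
        ιconst f0            ≈⟨ 0K≈ιconst0 ⟨
        0K                   ∎)
      (begin
        w₀ * v₁ + - v₀ * w₁  ≈⟨ solve 4 (λ v₀ v₁ w₀ w₁ → w₀ :* v₁ :+ :- v₀ :* w₁ := :- (v₀ :* w₁ :- v₁ :* w₀)) (λ _ → refl) v₀ v₁ w₀ w₁ ⟩
        - Δ                  ≈⟨ -‿cong {Δ} {0K} Δ≈0 ⟩
        - 0K                 ≈⟨ (λ _ → refl) ⟩
        0K                   ∎)
    column₁ : w₁ ≈ 0K × - v₁ ≈ 0K
    column₁ = u₀,u₁≈0⇒trivial independent w₁ (- v₁)
      (begin
        w₁ * v₀ + - v₁ * w₀  ≈⟨ solve 4 (λ v₀ v₁ w₀ w₁ → w₁ :* v₀ :+ :- v₁ :* w₀ := v₀ :* w₁ :- v₁ :* w₀) (λ _ → refl) v₀ v₁ w₀ w₁ ⟩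
        Δ                    ≈⟨ Δ≈0 ⟩
        0K                   ∎)
      (begin
        w₁ * v₁ + - v₁ * w₁  ≈⟨ solve 2 (λ v₁ w₁ → w₁ :* v₁ :+ :- v₁ :* w₁ := con f0) (λ _ → refl) v₁ w₁ ⟩
        ιconst f0            ≈⟨ 0K≈ιconst0 ⟨
        0K                   ∎)

lemma5p2 : (d : Kt) → InKˣ d → (b : PS) → ¬ ContainsRationalLine (Qb d (ι b))
lemma5p2 d (d≉0 , _) b (v , w , independent , on-line) = f1≢f0 (proj₁ 1≈0×0≈0 0)
  where
  open LineOnQuadric d b v w on-line
  open SetoidReasoning Kt-setoid
  v₀≈0×v₁≈0 : v (# 0) ≈ 0K × v (# 1) ≈ 0K
  v₀≈0×v₁≈0 = first-coordinates-vanish independent (determinant-vanishes d≉0)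
  1≈0×0≈0 : ιconst f1 ≈ 0K × ιconst f0 ≈ 0K
  1≈0×0≈0 = u₀,u₁≈0⇒trivial independent (ιconst f1) (ιconst f0)
    (begin lin (ιconst f1) v (ιconst f0) w (# 0) ≈⟨ v-on-line (# 0) ⟨ v (# 0) ≈⟨ proj₁ v₀≈0×v₁≈0 ⟩ 0K ∎)
    (begin lin (ιconst f1) v (ιconst f0) w (# 1) ≈⟨ v-on-line (# 1) ⟨ v (# 1) ≈⟨ proj₂ v₀≈0×v₁≈0 ⟩ 0K ∎)
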